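{- For any even $q\geq 2$ and any integer $\gamma$ with $\frac{q}{2}<\gamma<q$, there is a completely regular code in $H(3,q)$ with covering radius $1$, eigenvalue $\lambda_2(3,q)$ and parameter $\gamma$.
   Context: Let $\mathcal{A}$ be a set of size $q$; $H(3,q)$ has vertex set $\mathcal{A}^3$, tuples adjacent iff they differ in exactly one position; $\lambda_2(3,q)=q-3$. A set $C$ of vertices is a completely regular code with covering radius $1$ if $C$ is a nonempty proper subset and there are integers $\beta,\gamma\geq1$ such that every vertex of $C$ has exactly $\beta$ neighbours outside $C$ and every vertex outside $C$ has exactly $\gamma$ neighbours in $C$; it has eigenvalue $\lambda_2(3,q)$ iff $3(q-1)-(\beta+\gamma)=q-3$, i.e. $\beta+\gamma=2q$. -}

module Defs where

open import Data.Nat using (ℕ; _+_; _*_; _∸_; _≤_)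
open import Data.Fin using (Fin)
open import Data.Fin.Properties using (_≟_)
open import Data.Bool using (Bool; true; false; if_then_else_)
open import Data.List using (List; allFin; length; filter; map; concatMap; cartesianProduct)
open import Data.Product using (_×_; _,_; ∃)
open import Relation.Nullary.Decidable using (⌊_⌋; does)
open import Relation.Binary.PropositionalEquality using (_≡_)
import Data.Nat as ℕ
import Data.Bool

Vertex : ℕ → Set
Vertex q = Fin q × Fin q × Fin q

vertices : (q : ℕ) → List (Vertex q)
vertices q = cartesianProduct (allFin q) (cartesianProduct (allFin q) (allFin q))

differ : {q : ℕ} → Fin q → Fin q → ℕ
differ a b = if does (a ≟ b) then 0 else 1

dist : {q : ℕ} → Vertex q → Vertex q → ℕ
dist (a₁ , a₂ , a₃) (b₁ , b₂ , b₃) = differ a₁ b₁ + differ a₂ b₂ + differ a₃ b₃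

adjB : {q : ℕ} → Vertex q → Vertex q → Bool
adjB x y = ⌊ dist x y ℕ.≟ 1 ⌋

Code : ℕ → Set
Code q = Vertex q → Bool

nbrsIn : {q : ℕ} → Code q → Vertex q → ℕ
nbrsIn {q} C x = length (filter (λ y → adjB x y Data.Bool.≟ true) (filter (λ y → C y Data.Bool.≟ true) (vertices q)))

nbrsOut : {q : ℕ} → Code q → Vertex q → ℕ
nbrsOut {q} C x = length (filter (λ y → adjB x y Data.Bool.≟ true) (filter (λ y → C y Data.Bool.≟ false) (vertices q)))

record IsCRC1 (q : ℕ) (C : Code q) (β γ : ℕ) : Set where
  field
    nonempty  : ∃ λ (x : Vertex q) → C x ≡ true
    proper    : ∃ λ (x : Vertex q) → C x ≡ false
    β≥1       : 1 ≤ β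
    γ≥1       : 1 ≤ γ
    inside    : ∀ (x : Vertex q) → C x ≡ true  → nbrsOut C x ≡ β
    outside   : ∀ (x : Vertex q) → C x ≡ false → nbrsIn  C x ≡ γ

module Submission where

-- For a code C in H(3,q) and a vertex x, the three lines through x meet every neighbour of x once and
-- x itself three times, so the number of neighbours of x in C plus 3[x ∈ C] is the total size ℓ(x) of C
-- on those lines.  Hence a nonempty proper C with ℓ(x) = γ + q[x ∈ C] for all x is completely regular
-- with covering radius 1 and parameters (2q − γ, γ).
--
-- Write q = 2h and γ = h + b with 0 < b < h, and split the alphabet {0, …, q−1} into G = [0, γ) and
-- K = [γ, q).  The band D = {(x, y) ∈ G² : (x + y) mod γ < b} has b points in every row and column of
-- G², so P = (G × K) ∪ D has rows of size h on G and 0 on K, and columns of size b on G and γ on K.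
-- Taking C = P × [0, h) ∪ Pᵀ × [h, q), the condition on ℓ becomes one identity per choice of
-- G or K for the first two coordinates.

open import Defs
open import Data.Bool using (Bool; true; false; if_then_else_; not; _∧_; _∨_)
import Data.Bool as Bool
open import Data.Fin using (Fin; zero; suc; toℕ; fromℕ<)
open import Data.Fin.Properties using (toℕ<n; toℕ-fromℕ<)
import Data.Fin.Properties as Fin
open import Data.List using (List; []; _∷_; tabulate; cartesianProduct; filter; length)
import Data.List as List
open import Data.List.Properties using (map-++; map-∘)
import Data.Nat.ListAction as L
open import Data.Nat.ListAction.Properties using (sum-++)
open import Data.Nat using (ℕ; zero; suc; _+_; _*_; _∸_; _<_; _≤_; _⊓_; _<?_; NonZero; >-nonZero)
open import Data.Nat.Divisibility using (_∣_; divides)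
open import Data.Nat.DivMod using (_%_; [m+n]%n≡m%n; m<n⇒m%n≡m)
import Data.Nat.Properties as ℕ
open import Algebra.Properties.CommutativeSemigroup ℕ.+-commutativeSemigroup using (interchange)
open import Algebra.Properties.CommutativeMonoid.Sum ℕ.+-0-commutativeMonoid
  using (sum; sum-cong-≗; ∑-distrib-+; sum-replicate-zero)
open import Data.Product using (Σ; ∃; ∃₂; _×_; _,_)
open import Function using (_∘_)
open import Relation.Binary.PropositionalEquality
open import Relation.Nullary.Decidable using (yes; no; does; dec-true; dec-false)
open import Relation.Unary using (Pred; Decidable)
open import Data.Nat.Tactic.RingSolver using (solve-∀)

open ≡-Reasoning

-- Finite sums

ind : Bool → ℕ
ind true  = 1
ind false = 0

when : Bool → ℕ → ℕ
when d n = if d then n else 0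

∑-when : ∀ {n} d (f : Fin n → ℕ) → sum (λ i → when d (f i)) ≡ when d (sum f)
∑-when true  f = refl
∑-when {n} false f = sum-replicate-zero n

∑-δ : ∀ {n} (x : Fin n) (f : Fin n → ℕ) → sum (λ a → when (does (x Fin.≟ a)) (f a)) ≡ f x
∑-δ {suc n} zero    f = trans (cong (f zero +_) (sum-replicate-zero n)) (ℕ.+-identityʳ (f zero))
∑-δ {suc n} (suc x) f = ∑-δ x (f ∘ suc)

count : ℕ → (ℕ → Bool) → ℕ
count n p = sum (λ (i : Fin n) → ind (p (toℕ i)))

count-cong-< : ∀ n {p p′ : ℕ → Bool} → (∀ i → i < n → p i ≡ p′ i) → count n p ≡ count n p′
count-cong-< n eq = sum-cong-≗ (λ i → cong ind (eq (toℕ i) (toℕ<n i)))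

count-++ : ∀ m n p → count (m + n) p ≡ count m p + count n (λ i → p (m + i))
count-++ zero    n p = refl
count-++ (suc m) n p = trans (cong (ind (p 0) +_) (count-++ m n (p ∘ suc))) (sym (ℕ.+-assoc (ind (p 0)) _ _))

count-const : ∀ n t → count n (λ _ → t) ≡ n * ind t
count-const zero    t = refl
count-const (suc n) t = cong (ind t +_) (count-const n t)

count-true : ∀ n → count n (λ _ → true) ≡ n
count-true n = trans (count-const n true) (ℕ.*-identityʳ n)

count-false : ∀ n → count n (λ _ → false) ≡ 0
count-false n = trans (count-const n false) (ℕ.*-zeroʳ n)

count-< : ∀ n m → count n (λ i → does (i <? m)) ≡ n ⊓ m
count-< zero    m       = refl
count-< (suc n) zero    = count-false n
count-< (suc n) (suc m) = cong suc (count-< n m)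

count-periodic : ∀ n {p : ℕ → Bool} → (∀ s → p (s + n) ≡ p s) → ∀ x → count n (λ i → p (x + i)) ≡ count n p
count-periodic n {p} periodic x = ℕ.+-cancelˡ-≡ (count x p) _ _ (begin
  count x p + count n (λ i → p (x + i)) ≡⟨ count-++ x n p ⟨
  count (x + n) p                       ≡⟨ cong (λ m → count m p) (ℕ.+-comm x n) ⟩
  count (n + x) p                       ≡⟨ count-++ n x p ⟩
  count n p + count x (λ i → p (n + i)) ≡⟨ cong (count n p +_) (count-cong-< x λ i _ → trans (cong p (ℕ.+-comm n i))
                                                                                            (periodic i)) ⟩
  count n p + count x p                 ≡⟨ ℕ.+-comm (count n p) (count x p) ⟩
  count x p + count n p                 ∎)

-- Lines and neighbourhoods in H(3,q)

length-filter-filter : ∀ {a ℓ} {A : Set a} {Q : Pred A ℓ} (Q? : Decidable Q) (F : A → Bool) (xs : List A) →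
  length (filter (λ y → F y Bool.≟ true) (filter Q? xs)) ≡ L.sum (List.map (λ y → when (F y) (ind (does (Q? y)))) xs)
length-filter-filter Q? F []       = refl
length-filter-filter Q? F (y ∷ xs) with does (Q? y)
... | false with F y
...   | true  = length-filter-filter Q? F xs
...   | false = length-filter-filter Q? F xs
length-filter-filter Q? F (y ∷ xs) | true with F y
...   | true  = cong suc (length-filter-filter Q? F xs)
...   | false = length-filter-filter Q? F xs

sum-tabulate : ∀ {A : Set} n (g : Fin n → A) (F : A → ℕ) → L.sum (List.map F (tabulate g)) ≡ sum (F ∘ g)
sum-tabulate zero    g F = refl
sum-tabulate (suc n) g F = cong (F (g zero) +_) (sum-tabulate n (g ∘ suc) F)

sum-cartesianProduct : ∀ {A B : Set} (F : A × B → ℕ) (xs : List A) (ys : List B) →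
  L.sum (List.map F (cartesianProduct xs ys)) ≡ L.sum (List.map (λ x → L.sum (List.map (λ y → F (x , y)) ys)) xs)
sum-cartesianProduct F []       ys = refl
sum-cartesianProduct F (x ∷ xs) ys = begin
  L.sum (List.map F (List.map (x ,_) ys List.++ cartesianProduct xs ys))
    ≡⟨ cong L.sum (map-++ F (List.map (x ,_) ys) _) ⟩
  L.sum (List.map F (List.map (x ,_) ys) List.++ List.map F (cartesianProduct xs ys))
    ≡⟨ sum-++ (List.map F (List.map (x ,_) ys)) _ ⟩
  L.sum (List.map F (List.map (x ,_) ys)) + L.sum (List.map F (cartesianProduct xs ys))
    ≡⟨ cong₂ _+_ (cong L.sum (sym (map-∘ ys))) (sum-cartesianProduct F xs ys) ⟩
  L.sum (List.map (λ y → F (x , y)) ys) + _ ∎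

sum-allFin× : ∀ {B : Set} n (ys : List B) (F : Fin n × B → ℕ) →
  L.sum (List.map F (cartesianProduct (List.allFin n) ys)) ≡ sum λ i → L.sum (List.map (λ y → F (i , y)) ys)
sum-allFin× n ys F = trans (sum-cartesianProduct F (List.allFin n) ys) (sum-tabulate n (λ i → i) _)

module _ {q : ℕ} where

  ∑ᵥ : (Vertex q → ℕ) → ℕ
  ∑ᵥ F = sum λ a → sum λ b → sum λ c → F (a , b , c)

  sum-vertices : (F : Vertex q → ℕ) → L.sum (List.map F (vertices q)) ≡ ∑ᵥ F
  sum-vertices F = trans (sum-allFin× q _ F) (sum-cong-≗ λ a →
    trans (sum-allFin× q (List.allFin q) (F ∘ (a ,_))) (sum-cong-≗ λ b → sum-tabulate q (λ c → c) (λ c → F (a , b , c))))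

  ∑ᵥ-distrib-+ : (F G : Vertex q → ℕ) → ∑ᵥ (λ v → F v + G v) ≡ ∑ᵥ F + ∑ᵥ G
  ∑ᵥ-distrib-+ F G = trans (sum-cong-≗ plane) (∑-distrib-+ (λ a → ∑² (F ∘ (a ,_))) (λ a → ∑² (G ∘ (a ,_))))
    where
    ∑² : (Fin q × Fin q → ℕ) → ℕ
    ∑² H = sum λ b → sum λ c → H (b , c)
    plane : ∀ a → ∑² (λ bc → F (a , bc) + G (a , bc)) ≡ ∑² (F ∘ (a ,_)) + ∑² (G ∘ (a ,_))
    plane a = trans (sum-cong-≗ λ b → ∑-distrib-+ (λ c → F (a , b , c)) (λ c → G (a , b , c)))
                    (∑-distrib-+ (λ b → sum λ c → F (a , b , c)) (λ b → sum λ c → G (a , b , c)))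

  lineSum : (Vertex q → Bool) → Vertex q → ℕ
  lineSum f (x₁ , x₂ , x₃) =
    sum (λ a → ind (f (a , x₂ , x₃))) + sum (λ b → ind (f (x₁ , b , x₃))) + sum (λ c → ind (f (x₁ , x₂ , c)))

  ∑²-when : ∀ d (H : Fin q → Fin q → ℕ) → (sum λ b → sum λ c → when d (H b c)) ≡ when d (sum λ b → sum λ c → H b c)
  ∑²-when d H = trans (sum-cong-≗ λ b → ∑-when d (H b)) (∑-when d λ b → sum (H b))

  ∑²-δδ : ∀ (y z : Fin q) (H : Fin q → Fin q → ℕ) →
    (sum λ b → sum λ c → when (does (y Fin.≟ b)) (when (does (z Fin.≟ c)) (H b c))) ≡ H y z
  ∑²-δδ y z H = trans (sum-cong-≗ λ b → trans (∑-when (does (y Fin.≟ b)) λ c → when (does (z Fin.≟ c)) (H b c))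
                                               (cong (when (does (y Fin.≟ b))) (∑-δ z (H b))))
                      (∑-δ y λ b → H b z)

  ∑ᵥ-δ₁ : ∀ (x₁ : Fin q) (F : Vertex q → ℕ) →
    ∑ᵥ (λ { (a , b , c) → when (does (x₁ Fin.≟ a)) (F (a , b , c)) }) ≡ (sum λ b → sum λ c → F (x₁ , b , c))
  ∑ᵥ-δ₁ x₁ F = trans (sum-cong-≗ λ a → ∑²-when (does (x₁ Fin.≟ a)) (λ b c → F (a , b , c)))
                     (∑-δ x₁ λ a → sum λ b → sum λ c → F (a , b , c))

  line-cover : ∀ (x₁ x₂ x₃ a b c : Fin q) (w : ℕ) →
    let δ₁ = does (x₁ Fin.≟ a); δ₂ = does (x₂ Fin.≟ b); δ₃ = does (x₃ Fin.≟ c)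
        self = when δ₁ (when δ₂ (when δ₃ w))
    in
    when (adjB (x₁ , x₂ , x₃) (a , b , c)) w + (self + self + self)
      ≡ when δ₂ (when δ₃ w) + when δ₁ (when δ₃ w) + when δ₁ (when δ₂ w)
  line-cover x₁ x₂ x₃ a b c w with does (x₁ Fin.≟ a) | does (x₂ Fin.≟ b) | does (x₃ Fin.≟ c)
  ... | true  | true  | true  = refl
  ... | true  | true  | false = ℕ.+-identityʳ w
  ... | true  | false | true  = refl
  ... | false | true  | true  = sym (ℕ.+-identityʳ (w + 0))
  ... | true  | false | false = refl
  ... | false | true  | false = refl
  ... | false | false | true  = refl
  ... | false | false | false = refl

  ∑ᵥ-cong : {F G : Vertex q → ℕ} → (∀ v → F v ≡ G v) → ∑ᵥ F ≡ ∑ᵥ G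
  ∑ᵥ-cong eq = sum-cong-≗ λ a → sum-cong-≗ λ b → sum-cong-≗ λ c → eq (a , b , c)

  ∑ᵥ-distrib-+₃ : (F G H : Vertex q → ℕ) → ∑ᵥ (λ v → F v + G v + H v) ≡ ∑ᵥ F + ∑ᵥ G + ∑ᵥ H
  ∑ᵥ-distrib-+₃ F G H = trans (∑ᵥ-distrib-+ (λ v → F v + G v) H) (cong (_+ ∑ᵥ H) (∑ᵥ-distrib-+ F G))

  nbrs+3·self≡lineSum : ∀ {ℓ} {Q : Pred (Vertex q) ℓ} (Q? : Decidable Q) (x : Vertex q) →
    length (filter (λ y → adjB x y Bool.≟ true) (filter Q? (vertices q))) + 3 * ind (does (Q? x)) ≡ lineSum (does ∘ Q?) x
  nbrs+3·self≡lineSum Q? x@(x₁ , x₂ , x₃) = begin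
    length (filter (λ y → adjB x y Bool.≟ true) (filter Q? (vertices q))) + 3 * w x
      ≡⟨ cong₂ _+_ (trans (length-filter-filter Q? (adjB x) (vertices q)) (sum-vertices A)) (3*n≡n+n+n (w x)) ⟩
    ∑ᵥ A + (w x + w x + w x)
      ≡⟨ cong (∑ᵥ A +_) (trans (∑ᵥ-distrib-+₃ T T T) (cong₂ _+_ (cong₂ _+_ self self) self)) ⟨
    ∑ᵥ A + ∑ᵥ (λ v → T v + T v + T v)
      ≡⟨ ∑ᵥ-distrib-+ A (λ v → T v + T v + T v) ⟨
    ∑ᵥ (λ v → A v + (T v + T v + T v))
      ≡⟨ ∑ᵥ-cong (λ { (a , b , c) → line-cover x₁ x₂ x₃ a b c (w (a , b , c)) }) ⟩
    ∑ᵥ (λ v → L₁ v + L₂ v + L₃ v)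
      ≡⟨ ∑ᵥ-distrib-+₃ L₁ L₂ L₃ ⟩
    ∑ᵥ L₁ + ∑ᵥ L₂ + ∑ᵥ L₃
      ≡⟨ cong₂ _+_ (cong₂ _+_ line₁ line₂) line₃ ⟩
    lineSum (does ∘ Q?) x ∎
    where
    w : Vertex q → ℕ
    w v = ind (does (Q? v))
    δ : Fin q → Fin q → Bool
    δ i j = does (i Fin.≟ j)
    A T L₁ L₂ L₃ : Vertex q → ℕ
    A v = when (adjB x v) (w v)
    T v@(a , b , c) = when (δ x₁ a) (when (δ x₂ b) (when (δ x₃ c) (w v)))
    L₁ v@(a , b , c) = when (δ x₂ b) (when (δ x₃ c) (w v))
    L₂ v@(a , b , c) = when (δ x₁ a) (when (δ x₃ c) (w v))
    L₃ v@(a , b , c) = when (δ x₁ a) (when (δ x₂ b) (w v))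
    3*n≡n+n+n : ∀ n → 3 * n ≡ n + n + n
    3*n≡n+n+n n = trans (cong (λ m → n + (n + m)) (ℕ.+-identityʳ n)) (sym (ℕ.+-assoc n n n))
    self : ∑ᵥ T ≡ w x
    self = trans (∑ᵥ-δ₁ x₁ λ { v@(a , b , c) → when (δ x₂ b) (when (δ x₃ c) (w v)) })
                 (∑²-δδ x₂ x₃ λ b c → w (x₁ , b , c))
    line₁ : ∑ᵥ L₁ ≡ sum λ a → w (a , x₂ , x₃)
    line₁ = sum-cong-≗ λ a → ∑²-δδ x₂ x₃ λ b c → w (a , b , c)
    line₂ : ∑ᵥ L₂ ≡ sum λ b → w (x₁ , b , x₃)
    line₂ = trans (∑ᵥ-δ₁ x₁ λ { v@(a , b , c) → when (δ x₃ c) (w v) }) (sum-cong-≗ λ b → ∑-δ x₃ λ c → w (x₁ , b , c))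
    line₃ : ∑ᵥ L₃ ≡ sum λ c → w (x₁ , x₂ , c)
    line₃ = begin
      ∑ᵥ L₃                                                 ≡⟨ ∑ᵥ-δ₁ x₁ (λ { v@(a , b , c) → when (δ x₂ b) (w v) }) ⟩
      (sum λ b → sum λ c → when (δ x₂ b) (w (x₁ , b , c)))  ≡⟨ sum-cong-≗ (λ b → ∑-when (δ x₂ b) λ c → w (x₁ , b , c)) ⟩
      (sum λ b → when (δ x₂ b) (sum λ c → w (x₁ , b , c)))  ≡⟨ ∑-δ x₂ (λ b → sum λ c → w (x₁ , b , c)) ⟩
      (sum λ c → w (x₁ , x₂ , c))                           ∎

  lineSum-cong : {f g : Vertex q → Bool} → (∀ v → f v ≡ g v) → ∀ x → lineSum f x ≡ lineSum g x
  lineSum-cong eq (x₁ , x₂ , x₃) = cong₂ _+_ (cong₂ _+_ (sum-cong-≗ λ a → cong ind (eq (a , x₂ , x₃)))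
                                                       (sum-cong-≗ λ b → cong ind (eq (x₁ , b , x₃))))
                                            (sum-cong-≗ λ c → cong ind (eq (x₁ , x₂ , c)))

  lineSum-not+lineSum : (f : Vertex q → Bool) → ∀ x → lineSum (not ∘ f) x + lineSum f x ≡ q + q + q
  lineSum-not+lineSum f (x₁ , x₂ , x₃) =
    trans (trans (interchange (∑ᶜ l₁ + ∑ᶜ l₂) (∑ᶜ l₃) (∑ l₁ + ∑ l₂) (∑ l₃))
                 (cong (_+ (∑ᶜ l₃ + ∑ l₃)) (interchange (∑ᶜ l₁) (∑ᶜ l₂) (∑ l₁) (∑ l₂))))
          (cong₂ _+_ (cong₂ _+_ (not+id l₁) (not+id l₂)) (not+id l₃))
    where
    l₁ l₂ l₃ : Fin q → Bool
    l₁ a = f (a , x₂ , x₃)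
    l₂ b = f (x₁ , b , x₃)
    l₃ c = f (x₁ , x₂ , c)
    ∑ ∑ᶜ : (Fin q → Bool) → ℕ
    ∑ p = sum (ind ∘ p)
    ∑ᶜ p = sum (ind ∘ not ∘ p)
    not+id : (p : Fin q → Bool) → ∑ᶜ p + ∑ p ≡ q
    not+id p = trans (sym (∑-distrib-+ (ind ∘ not ∘ p) (ind ∘ p)))
                     (trans (sum-cong-≗ λ i → ind-not+ind (p i)) (count-true q))
      where
      ind-not+ind : ∀ t → ind (not t) + ind t ≡ 1
      ind-not+ind true  = refl
      ind-not+ind false = refl

  nbrsIn+3·self≡lineSum : (C : Code q) (x : Vertex q) → nbrsIn C x + 3 * ind (C x) ≡ lineSum C x
  nbrsIn+3·self≡lineSum C x = begin
    nbrsIn C x + 3 * ind (C x)                        ≡⟨ cong (λ t → nbrsIn C x + 3 * ind t) (≟true (C x)) ⟨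
    nbrsIn C x + 3 * ind (does (C x Bool.≟ true))     ≡⟨ nbrs+3·self≡lineSum (λ y → C y Bool.≟ true) x ⟩
    lineSum (λ y → does (C y Bool.≟ true)) x          ≡⟨ lineSum-cong (≟true ∘ C) x ⟩
    lineSum C x                                       ∎
    where
    ≟true : ∀ t → does (t Bool.≟ true) ≡ t
    ≟true true  = refl
    ≟true false = refl

  nbrsOut+3·self≡lineSum : (C : Code q) (x : Vertex q) → nbrsOut C x + 3 * ind (not (C x)) ≡ lineSum (not ∘ C) x
  nbrsOut+3·self≡lineSum C x = begin
    nbrsOut C x + 3 * ind (not (C x))                 ≡⟨ cong (λ t → nbrsOut C x + 3 * ind t) (≟false (C x)) ⟨
    nbrsOut C x + 3 * ind (does (C x Bool.≟ false))   ≡⟨ nbrs+3·self≡lineSum (λ y → C y Bool.≟ false) x ⟩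
    lineSum (λ y → does (C y Bool.≟ false)) x         ≡⟨ lineSum-cong (≟false ∘ C) x ⟩
    lineSum (not ∘ C) x                               ∎
    where
    ≟false : ∀ t → does (t Bool.≟ false) ≡ not t
    ≟false true  = refl
    ≟false false = refl

  isCRC1-fromLineSums : (C : Code q) {β γ : ℕ} → β + γ ≡ 2 * q → 1 ≤ β → 1 ≤ γ →
    (∃ λ x → C x ≡ true) → (∃ λ x → C x ≡ false) →
    (∀ v → lineSum C v ≡ γ + q * ind (C v)) → IsCRC1 q C β γ
  isCRC1-fromLineSums C {β} {γ} β+γ≡2q 1≤β 1≤γ nonempty proper lineSum≡ = record
    { nonempty = nonempty ; proper = proper ; β≥1 = 1≤β ; γ≥1 = 1≤γ ; inside = inside ; outside = outside }
    where
    outside : ∀ x → C x ≡ false → nbrsIn C x ≡ γ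
    outside x Cx≡false = begin
      nbrsIn C x                    ≡⟨ ℕ.+-identityʳ (nbrsIn C x) ⟨
      nbrsIn C x + 3 * ind false    ≡⟨ cong (λ t → nbrsIn C x + 3 * ind t) Cx≡false ⟨
      nbrsIn C x + 3 * ind (C x)    ≡⟨ nbrsIn+3·self≡lineSum C x ⟩
      lineSum C x                   ≡⟨ lineSum≡ x ⟩
      γ + q * ind (C x)             ≡⟨ cong (λ t → γ + q * ind t) Cx≡false ⟩
      γ + q * 0                     ≡⟨ cong (γ +_) (ℕ.*-zeroʳ q) ⟩
      γ + 0                         ≡⟨ ℕ.+-identityʳ γ ⟩
      γ                             ∎
    inside : ∀ x → C x ≡ true → nbrsOut C x ≡ β
    inside x Cx≡true = ℕ.+-cancelʳ-≡ (γ + q) (nbrsOut C x) β (begin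
      nbrsOut C x + (γ + q)                                 ≡⟨ cong (_+ (γ + q)) (ℕ.+-identityʳ (nbrsOut C x)) ⟨
      nbrsOut C x + 3 * ind (not true) + (γ + q)            ≡⟨ cong (λ t → nbrsOut C x + 3 * ind (not t) + (γ + q)) Cx≡true ⟨
      nbrsOut C x + 3 * ind (not (C x)) + (γ + q)           ≡⟨ cong₂ _+_ (nbrsOut+3·self≡lineSum C x) lineSum-inside ⟩
      lineSum (not ∘ C) x + lineSum C x                     ≡⟨ lineSum-not+lineSum C x ⟩
      q + q + q                                             ≡⟨ cong (_+ q) (trans β+γ≡2q (cong (q +_) (ℕ.+-identityʳ q))) ⟨
      β + γ + q                                             ≡⟨ ℕ.+-assoc β γ q ⟩
      β + (γ + q)                                           ∎)
      where
      lineSum-inside : γ + q ≡ lineSum C x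
      lineSum-inside = sym (trans (trans (lineSum≡ x) (cong (λ t → γ + q * ind t) Cx≡true)) (cong (γ +_) (ℕ.*-identityʳ q)))

-- The construction

even-split : ∀ {q γ} → 2 ∣ q → q < 2 * γ → γ < q →
  ∃₂ λ b k → 1 ≤ b × 1 ≤ k × (b + k) + (b + k) ≡ q × (b + k) + b ≡ γ
even-split {q} {γ} (divides h q≡h*2) q<2γ γ<q = b , h ∸ b , 1≤b , 1≤k , b+k+[b+k]≡q , b+k+b≡γ
  where
  q≡h+h : q ≡ h + h
  q≡h+h = trans q≡h*2 (trans (ℕ.*-comm h 2) (cong (h +_) (ℕ.+-identityʳ h)))
  h<γ : h < γ
  h<γ = ℕ.*-cancelʳ-< 2 h γ (subst₂ _<_ q≡h*2 (ℕ.*-comm 2 γ) q<2γ)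
  b : ℕ
  b = γ ∸ h
  h+b≡γ : h + b ≡ γ
  h+b≡γ = ℕ.m+[n∸m]≡n (ℕ.<⇒≤ h<γ)
  1≤b : 1 ≤ b
  1≤b = ℕ.m<n⇒0<n∸m h<γ
  b<h : b < h
  b<h = ℕ.+-cancelˡ-< h b h (subst₂ _<_ (sym h+b≡γ) q≡h+h γ<q)
  1≤k : 1 ≤ h ∸ b
  1≤k = ℕ.m<n⇒0<n∸m b<h
  b+k≡h : b + (h ∸ b) ≡ h
  b+k≡h = ℕ.m+[n∸m]≡n (ℕ.<⇒≤ b<h)
  b+k+[b+k]≡q : b + (h ∸ b) + (b + (h ∸ b)) ≡ q
  b+k+[b+k]≡q = trans (cong₂ _+_ b+k≡h b+k≡h) (sym q≡h+h)
  b+k+b≡γ : b + (h ∸ b) + b ≡ γ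
  b+k+b≡γ = trans (cong (_+ b) b+k≡h) h+b≡γ

open import Data.Integer using (+_; _-_; _⊖_)
open import Data.Integer.Properties using (m-n≡m⊖n; +-cancelˡ-⊖)

λ₂-eigenvalue : ∀ {q β γ} → 1 ≤ q → β + γ ≡ 2 * q → + (3 * (q ∸ 1)) - + (β + γ) ≡ + q - + 3
λ₂-eigenvalue {suc m} {β} {γ} _ β+γ≡2q = begin
  + (3 * m) - + (β + γ)           ≡⟨ cong (λ n → + (3 * m) - + n) β+γ≡2q ⟩
  + (3 * m) - + (2 * suc m)       ≡⟨ m-n≡m⊖n (3 * m) (2 * suc m) ⟩
  (3 * m) ⊖ (2 * suc m)           ≡⟨ cong₂ _⊖_ (3m m) (2[1+m] m) ⟩
  (2 * m + m) ⊖ (2 * m + 2)       ≡⟨ +-cancelˡ-⊖ (2 * m) m 2 ⟩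
  m ⊖ 2                           ≡⟨ +-cancelˡ-⊖ 1 m 2 ⟨
  suc m ⊖ 3                       ≡⟨ m-n≡m⊖n (suc m) 3 ⟨
  + suc m - + 3                   ∎
  where
  3m : ∀ m → 3 * m ≡ 2 * m + m
  3m = solve-∀
  2[1+m] : ∀ m → 2 * suc m ≡ 2 * m + 2
  2[1+m] = solve-∀

module Construction (b k : ℕ) (1≤b : 1 ≤ b) (1≤k : 1 ≤ k) where

  h γ q : ℕ
  h = b + k
  γ = h + b
  q = h + h

  instance
    γ-nonZero : NonZero γ
    γ-nonZero = >-nonZero (ℕ.≤-trans 1≤b (ℕ.m≤n+m b h))

  D : ℕ → ℕ → Bool
  D x y = does ((x + y) % γ <? b)

  P : ℕ → ℕ → Bool
  P x y = does (x <? γ) ∧ (not (does (y <? γ)) ∨ D x y)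

  layered : ℕ → ℕ → ℕ → Bool
  layered x y z = if does (z <? h) then P x y else P y x

  C : Code q
  C (x , y , z) = layered (toℕ x) (toℕ y) (toℕ z)

  D-sym : ∀ x y → D x y ≡ D y x
  D-sym x y = cong (λ s → does (s % γ <? b)) (ℕ.+-comm x y)

  D-row : ∀ x → count γ (D x) ≡ b
  D-row x = begin
    count γ (λ i → mod<b (x + i))   ≡⟨ count-periodic γ (λ s → cong (λ r → does (r <? b)) ([m+n]%n≡m%n s γ)) x ⟩
    count γ mod<b                   ≡⟨ count-cong-< γ (λ i i<γ → cong (λ r → does (r <? b)) (m<n⇒m%n≡m i<γ)) ⟩
    count γ (λ i → does (i <? b))   ≡⟨ count-< γ b ⟩
    γ ⊓ b                           ≡⟨ ℕ.m≥n⇒m⊓n≡n (ℕ.m≤n+m b h) ⟩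
    b                               ∎
    where
    mod<b : ℕ → Bool
    mod<b s = does (s % γ <? b)

  D-col : ∀ y → count γ (λ x → D x y) ≡ b
  D-col y = trans (count-cong-< γ (λ x _ → D-sym x y)) (D-row y)

  P-GG : ∀ {x y} → x < γ → y < γ → P x y ≡ D x y
  P-GG {x} {y} x<γ y<γ rewrite dec-true (x <? γ) x<γ | dec-true (y <? γ) y<γ = refl

  P-GK : ∀ {x y} → x < γ → γ ≤ y → P x y ≡ true
  P-GK {x} {y} x<γ γ≤y rewrite dec-true (x <? γ) x<γ | dec-false (y <? γ) (ℕ.≤⇒≯ γ≤y) = refl

  P-K : ∀ {x y} → γ ≤ x → P x y ≡ false
  P-K {x} γ≤x rewrite dec-false (x <? γ) (ℕ.≤⇒≯ γ≤x) = refl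

  count-q≡γ+k : ∀ p → count q p ≡ count γ p + count k (λ i → p (γ + i))
  count-q≡γ+k p = trans (cong (λ n → count n p) (sym (ℕ.+-assoc h b k))) (count-++ γ k p)

  row-G : ∀ {x} → x < γ → count q (P x) ≡ h
  row-G {x} x<γ = trans (count-q≡γ+k (P x)) (cong₂ _+_
    (trans (count-cong-< γ λ _ y<γ → P-GG x<γ y<γ) (D-row x))
    (trans (count-cong-< k λ i _ → P-GK x<γ (ℕ.m≤m+n γ i)) (count-true k)))

  row-K : ∀ {x} → γ ≤ x → count q (P x) ≡ 0
  row-K {x} γ≤x = trans (count-cong-< q λ y _ → P-K {x} {y} γ≤x) (count-false q)

  col-G : ∀ {y} → y < γ → count q (λ x → P x y) ≡ b
  col-G {y} y<γ = trans (count-q≡γ+k (λ x → P x y)) (trans (cong₂ _+_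
    (trans (count-cong-< γ λ _ x<γ → P-GG x<γ y<γ) (D-col y))
    (trans (count-cong-< k λ i _ → P-K (ℕ.m≤m+n γ i)) (count-false k))) (ℕ.+-identityʳ b))

  col-K : ∀ {y} → γ ≤ y → count q (λ x → P x y) ≡ γ
  col-K {y} γ≤y = trans (count-q≡γ+k (λ x → P x y)) (trans (cong₂ _+_
    (trans (count-cong-< γ λ _ x<γ → P-GK x<γ γ≤y) (count-true γ))
    (trans (count-cong-< k λ i _ → P-K (ℕ.m≤m+n γ i)) (count-false k))) (ℕ.+-identityʳ γ))

  balance : ∀ x y → count q (λ a → P a y) + count q (P x) + (h * ind (P x y) + h * ind (P y x)) ≡ γ + q * ind (P x y)
  balance x y with x <? γ | y <? γ
  ... | yes x<γ | yes y<γ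
    rewrite col-G y<γ | row-G x<γ | P-GG x<γ y<γ | P-GG y<γ x<γ | D-sym y x = GG b h (ind (D x y))
    where
    GG : ∀ b h n → b + h + (h * n + h * n) ≡ h + b + (h + h) * n
    GG = solve-∀
  ... | yes x<γ | no y≮γ
    rewrite col-K (ℕ.≮⇒≥ y≮γ) | row-G x<γ | P-GK x<γ (ℕ.≮⇒≥ y≮γ) | P-K {y} {x} (ℕ.≮⇒≥ y≮γ) = GK b h
    where
    GK : ∀ b h → h + b + h + (h * 1 + h * 0) ≡ h + b + (h + h) * 1
    GK = solve-∀
  ... | no x≮γ | yes y<γ
    rewrite col-G y<γ | row-K (ℕ.≮⇒≥ x≮γ) | P-K {x} {y} (ℕ.≮⇒≥ x≮γ) | P-GK y<γ (ℕ.≮⇒≥ x≮γ) = KG b h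
    where
    KG : ∀ b h → b + 0 + (h * 0 + h * 1) ≡ h + b + (h + h) * 0
    KG = solve-∀
  ... | no x≮γ | no y≮γ
    rewrite col-K (ℕ.≮⇒≥ y≮γ) | row-K (ℕ.≮⇒≥ x≮γ) | P-K {x} {y} (ℕ.≮⇒≥ x≮γ) | P-K {y} {x} (ℕ.≮⇒≥ y≮γ) = KK b h
    where
    KK : ∀ b h → h + b + 0 + (h * 0 + h * 0) ≡ h + b + (h + h) * 0
    KK = solve-∀

  layered-below : ∀ x y {z} → z < h → layered x y z ≡ P x y
  layered-below x y {z} z<h rewrite dec-true (z <? h) z<h = refl

  layered-above : ∀ x y {z} → h ≤ z → layered x y z ≡ P y x
  layered-above x y {z} h≤z rewrite dec-false (z <? h) (ℕ.≤⇒≯ h≤z) = refl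

  count-layers : ∀ x y → count q (layered x y) ≡ h * ind (P x y) + h * ind (P y x)
  count-layers x y = trans (count-++ h h (layered x y)) (cong₂ _+_
    (trans (count-cong-< h λ _ z<h → layered-below x y z<h) (count-const h (P x y)))
    (trans (count-cong-< h λ i _ → layered-above x y (ℕ.m≤m+n h i)) (count-const h (P y x))))

  C-lineSum : ∀ v → lineSum C v ≡ γ + q * ind (C v)
  C-lineSum (x , y , z) with toℕ z <? h
  ... | yes z<h = begin
    lineSum C (x , y , z)
      ≡⟨ cong₂ _+_ (cong₂ _+_ (count-cong-< q λ a _ → layered-below a y′ z<h)
                              (count-cong-< q λ b _ → layered-below x′ b z<h))
                   (count-layers x′ y′) ⟩
    count q (λ a → P a y′) + count q (P x′) + (h * ind (P x′ y′) + h * ind (P y′ x′))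
      ≡⟨ balance x′ y′ ⟩
    γ + q * ind (P x′ y′)
      ≡⟨ cong (λ t → γ + q * ind t) (layered-below x′ y′ z<h) ⟨
    γ + q * ind (C (x , y , z)) ∎
    where
    x′ y′ : ℕ
    x′ = toℕ x
    y′ = toℕ y
  ... | no z≮h = begin
    lineSum C (x , y , z)
      ≡⟨ cong₂ _+_ (cong₂ _+_ (count-cong-< q λ a _ → layered-above a y′ h≤z)
                              (count-cong-< q λ b _ → layered-above x′ b h≤z))
                   (count-layers x′ y′) ⟩
    count q (P y′) + count q (λ b → P b x′) + (h * ind (P x′ y′) + h * ind (P y′ x′))
      ≡⟨ cong₂ _+_ (ℕ.+-comm (count q (P y′)) _) (ℕ.+-comm (h * ind (P x′ y′)) _) ⟩
    count q (λ b → P b x′) + count q (P y′) + (h * ind (P y′ x′) + h * ind (P x′ y′))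
      ≡⟨ balance y′ x′ ⟩
    γ + q * ind (P y′ x′)
      ≡⟨ cong (λ t → γ + q * ind t) (layered-above x′ y′ h≤z) ⟨
    γ + q * ind (C (x , y , z)) ∎
    where
    x′ y′ : ℕ
    x′ = toℕ x
    y′ = toℕ y
    h≤z : h ≤ toℕ z
    h≤z = ℕ.≮⇒≥ z≮h

  0<h : 0 < h
  0<h = ℕ.≤-trans 1≤b (ℕ.m≤m+n b k)

  0<γ : 0 < γ
  0<γ = ℕ.≤-trans 0<h (ℕ.m≤m+n h b)

  γ<q : γ < q
  γ<q = ℕ.+-monoʳ-< h (ℕ.m<m+n b 1≤k)

  0<q : 0 < q
  0<q = ℕ.<-trans 0<γ γ<q

  C-fromℕ< : ∀ {x y z} (x<q : x < q) (y<q : y < q) (z<q : z < q) → C (fromℕ< x<q , fromℕ< y<q , fromℕ< z<q) ≡ layered x y z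
  C-fromℕ< x<q y<q z<q rewrite toℕ-fromℕ< x<q | toℕ-fromℕ< y<q | toℕ-fromℕ< z<q = refl

  completelyRegular : Σ (Code q) λ C → ∃ λ β → IsCRC1 q C β γ × (+ (3 * (q ∸ 1)) - + (β + γ) ≡ + q - + 3)
  completelyRegular =
    C , q + k , isCRC1-fromLineSums C β+γ≡2q 1≤β 0<γ inC outC C-lineSum , λ₂-eigenvalue {β = q + k} {γ = γ} 0<q β+γ≡2q
    where
    β+γ≡2q : q + k + γ ≡ 2 * q
    β+γ≡2q = ring b k
      where
      ring : ∀ b k → (b + k) + (b + k) + k + ((b + k) + b) ≡ 2 * ((b + k) + (b + k))
      ring = solve-∀
    1≤β : 1 ≤ q + k
    1≤β = ℕ.≤-trans 1≤k (ℕ.m≤n+m k q)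
    inC : ∃ λ v → C v ≡ true
    inC = _ , trans (C-fromℕ< 0<q γ<q 0<q) (trans (layered-below 0 γ 0<h) (P-GK 0<γ ℕ.≤-refl))
    outC : ∃ λ v → C v ≡ false
    outC = _ , trans (C-fromℕ< γ<q γ<q 0<q) (trans (layered-below γ γ 0<h) (P-K ℕ.≤-refl))

-- The hypothesis 2 ≤ q follows from the others.
theorem2 : (q : ℕ) → 2 ∣ q → 2 ≤ q → (γ : ℕ) → q < 2 * γ → γ < q →
    Σ (Code q) λ C → ∃ λ β → IsCRC1 q C β γ ×
    ((+ (3 * (q ∸ 1))) - (+ (β + γ)) ≡ (+ q) - (+ 3))
theorem2 q 2∣q _ γ q<2γ γ<q with even-split 2∣q q<2γ γ<q
... | b , k , 1≤b , 1≤k , refl , refl = Construction.completelyRegular b k 1≤b 1≤k
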